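{- For every $n\ge1$, the permutation $w=n\,(n-1)\cdots 2\,1\in S_n$ is the only permutation $w\in S_n$ with $\mathrm{stab}(w)=1$.
   Context: For $w=w_1\dots w_n\in S_n$, $T(w)$ is the standard skew tableau of shape $(n,n-1,\dots,1)/(n-1,\dots,1,0)$ ($n$ single-cell rows, each cell strictly northeast of the one in the row below) whose reading word (rows left to right, bottom row to top row) is $w$. For a standard skew tableau $S$ of size $m$ with weakly decreasing row sizes: $S+x$ adds $x$ to all entries; $S^{(k)}$ ($k\ge1$) has $i$-th row equal to the $i$-th row of $S$ followed immediately to the right by the $i$-th rows of $S+m,\dots,S+(k-1)m$; $S$ stabilizes at $k$ if every entry of $[(k-1)m+1,km]$ lies in the same row of $\mathrm{Rect}(S^{(k)})$ (jeu de taquin rectification) as in $S^{(k)}$; $\mathrm{stab}(S)$ is the least such $k\ge1$. $\mathrm{stab}(w):=\mathrm{stab}(T(w))$. -}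

module Defs where

open import Data.Nat using (ℕ; zero; suc; _+_; _*_; _∸_; _≤_; _<_; _<ᵇ_; _≡ᵇ_)
open import Data.Bool using (Bool; true; false; if_then_else_; _∨_)
open import Data.Maybe using (Maybe; just; nothing)
import Data.Maybe as Maybe
open import Data.List using (List; []; _∷_; _++_; length; map; replicate; tabulate; concatMap; upTo; take; _∷ʳ_)
open import Data.Nat.ListAction using (sum)
open import Data.Bool.ListAction using (any)
open import Data.Product using (_×_; _,_)
open import Data.Fin using (Fin; toℕ; opposite)
open import Data.Fin.Permutation using (Permutation′; _⟨$⟩ʳ_)
open import Relation.Binary.PropositionalEquality using (_≡_)
open import Relation.Nullary using (¬_)

-- A tableau is a list of rows, top row first.  A row is a list of
-- cells, column 0 first; 'nothing' = cell of the inner shape (empty),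
-- 'just v' = cell of the skew shape filled with v.  The inner cells of
-- a row form a prefix of it; the row length is the outer shape part.

Row : Set
Row = List (Maybe ℕ)

Tab : Set
Tab = List Row

_!!_ : {A : Set} → List A → ℕ → Maybe A
[] !! _ = nothing
(x ∷ xs) !! zero = just x
(x ∷ xs) !! suc n = xs !! n

modifyAt : {A : Set} → ℕ → (A → A) → List A → List A
modifyAt _ f [] = []
modifyAt zero f (x ∷ xs) = f x ∷ xs
modifyAt (suc n) f (x ∷ xs) = x ∷ modifyAt n f xs

cell : Tab → ℕ → ℕ → Maybe ℕ
cell T i c with T !! i
... | nothing = nothing
... | just r with r !! c
...   | just (just v) = just v
...   | _ = nothing

setCell : ℕ → ℕ → Maybe ℕ → Tab → Tab
setCell i c x = modifyAt i (modifyAt c (λ _ → x))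

filled : Row → List ℕ
filled [] = []
filled (nothing ∷ r) = filled r
filled (just v ∷ r) = v ∷ filled r

innerLen : Row → ℕ
innerLen (nothing ∷ r) = suc (innerLen r)
innerLen _ = zero

size : Tab → ℕ
size T = sum (map (λ r → length (filled r)) T)

innerSize : Tab → ℕ
innerSize T = sum (map innerLen T)

-- One jeu de taquin slide: the hole sits at (i , c); the smaller of the
-- right and lower neighbours moves into it; when neither exists, the hole
-- (now last cell of its row) is deleted.  Fuel: each step moves the hole
-- into a distinct filled cell, so (size T + 1) fuel always suffices.
slide : ℕ → ℕ → ℕ → Tab → Tab
slide zero i c T = T
slide (suc f) i c T with cell T i (suc c) | cell T (suc i) c
... | nothing | nothing = modifyAt i (take c) T
... | just r | nothing = slide f i (suc c) (setCell i (suc c) nothing (setCell i c (just r) T))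
... | nothing | just b = slide f (suc i) c (setCell (suc i) c nothing (setCell i c (just b) T))
... | just r | just b =
  if r <ᵇ b
  then slide f i (suc c) (setCell i (suc c) nothing (setCell i c (just r) T))
  else slide f (suc i) c (setCell (suc i) c nothing (setCell i c (just b) T))

-- an inner corner: the lowest row i with a nonempty inner part, column
-- (innerLen - 1); rows are indexed from the top starting at the given index
lastCorner : ℕ → Tab → Maybe (ℕ × ℕ)
lastCorner i [] = nothing
lastCorner i (r ∷ rs) with lastCorner (suc i) rs
... | just p = just p
... | nothing with innerLen r
...   | zero = nothing
...   | suc c = just (i , c)

-- repeated slides; each slide decreases innerSize by exactly one
rectify : ℕ → Tab → Tab
rectify zero T = T
rectify (suc f) T with lastCorner 0 T
... | nothing = T
... | just (i , c) = rectify f (slide (suc (size T)) i c T)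

Rect : Tab → Tab
Rect T = rectify (innerSize T) T

rowOf : ℕ → Tab → Maybe ℕ
rowOf x [] = nothing
rowOf x (r ∷ rs) =
  if any (λ v → v ≡ᵇ x) (filled r) then just 0 else Maybe.map suc (rowOf x rs)

-- S^(k): row i of S followed by the entries of row i of S + m, …, S + (k-1)m
power : ℕ → Tab → Tab
power k S = map extend S
  where
  m = size S
  extend : Row → Row
  extend r = r ++ concatMap (λ j → map (λ v → just (v + j * m)) (filled r))
                            (map suc (upTo (k ∸ 1)))

StabilizesAt : Tab → ℕ → Set
StabilizesAt S k =
  ∀ x → (k ∸ 1) * size S < x → x ≤ k * size S →
  rowOf x (Rect (power k S)) ≡ rowOf x (power k S)

StabIs : Tab → ℕ → Set
StabIs S k = 1 ≤ k × StabilizesAt S k × (∀ j → 1 ≤ j → j < k → ¬ StabilizesAt S j)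

-- T(w): row i (from the top, 0-indexed) has n-1-i empty cells followed by
-- the single entry w_{n-i} (1-indexed), so the reading word is w.
-- The value of w at position j (0-indexed) is toℕ (w ⟨$⟩ʳ j) + 1.
T : {n : ℕ} → Permutation′ n → Tab
T {n} w = tabulate (λ i → replicate (toℕ (opposite i)) nothing ∷ʳ just (suc (toℕ (w ⟨$⟩ʳ opposite i))))

-- Rectifying T(w) processes its rows from the bottom up.  As long as the
-- entries decrease going up, the entry of each new row slides left along
-- its row and comes to rest on top of the column formed below it, so
-- Rect T(w) is a single column and every entry keeps its row.  At the
-- lowest descent, an entry y directly above a smaller entry x, the slide
-- started in y's row moves x up into that row; as jeu de taquin never moves
-- an entry down, x ends in a higher row of Rect T(w) than of T(w).  Hence
-- T(w) stabilizes at 1 exactly when its entries increase from the top row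
-- down, that is, when w = n (n-1) ⋯ 1.

module Submission where

open import Defs
open import Data.Nat using (ℕ; zero; suc; _+_; _≤_; _<_; _<ᵇ_; _≡ᵇ_; z≤n; s≤s; z<s)
open import Data.Nat.Properties
open import Data.Nat.Tactic.RingSolver using (solve-∀)
open import Data.Nat.ListAction using (sum)
open import Data.Nat.ListAction.Properties using (sum-++)
open import Data.Bool using (true; false)
open import Data.Bool.ListAction using (any)
open import Data.Bool.Properties using (T-≡)
open import Data.Maybe using (just; nothing; _>>=_)
import Data.Maybe as Maybe
open import Data.Maybe.Effectful using (join)
open import Data.List using (List; []; _∷_; _++_; length; map; replicate; take; tabulate; _∷ʳ_; [_])
open import Data.List.Properties using (++-assoc; ++-identityʳ; map-++; map-cong; map-id; length-++; length-replicate; length-tabulate; tabulate-cong; ∷-injective)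
open import Data.List.Reverse using (Reverse; []; _∶_∶ʳ_; reverseView)
open import Data.List.Membership.Propositional using (_∈_; _∉_)
open import Data.List.Membership.Propositional.Properties using (∈-++⁺ʳ; ∈-tabulate⁻)
open import Data.List.Relation.Unary.Any as Any using (here; there)
open import Data.List.Relation.Unary.Any.Properties using (any⁻)
import Data.List.Relation.Unary.All as All
open import Data.List.Relation.Unary.Unique.Propositional using (Unique; _∷_)
open import Data.List.Relation.Unary.Unique.Propositional.Properties using (tabulate⁺; Unique[x∷xs]⇒x∉xs)
open import Data.List.Relation.Unary.Linked as Linked using (Linked; []; [-]; _∷_)
open import Data.Product using (∃-syntax; _×_; _,_; proj₁; proj₂)
open import Data.Sum using (_⊎_; inj₁; inj₂)
import Data.Sum as Sum
open import Data.Fin using (Fin; toℕ; opposite) renaming (zero to fzero; suc to fsuc)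
open import Data.Fin.Properties using (opposite-prop; opposite-suc; opposite-involutive; toℕ-injective; toℕ<n)
open import Data.Fin.Permutation using (Permutation′; _⟨$⟩ʳ_)
open import Function using (_∘_)
open import Function.Bundles using (_⇔_; mk⇔; Equivalence; Injection)
open import Function.Properties.Inverse using (↔⇒↣)
open import Function.Construct.Composition using (_⇔-∘_)
open import Function.Construct.Symmetry using (⇔-sym)
open import Relation.Binary.PropositionalEquality hiding ([_])
open import Relation.Nullary using (¬_; yes; no; contradiction)


replicate-∷ʳ : ∀ {A : Set} k (x y : A) → replicate (suc k) x ∷ʳ y ≡ replicate k x ++ x ∷ y ∷ []
replicate-∷ʳ zero    x y = refl
replicate-∷ʳ (suc k) x y = cong (x ∷_) (replicate-∷ʳ k x y)

!!-++ : ∀ {A : Set} (pre xs : List A) {k} j → length pre ≡ k → (pre ++ xs) !! (j + k) ≡ xs !! j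
!!-++ []        xs j refl rewrite +-identityʳ j = refl
!!-++ (x ∷ pre) xs j refl rewrite +-suc j (length pre) = !!-++ pre xs j refl

modifyAt-++ : ∀ {A : Set} (pre xs : List A) {k} j (g : A → A) → length pre ≡ k →
  modifyAt (j + k) g (pre ++ xs) ≡ pre ++ modifyAt j g xs
modifyAt-++ []        xs j g refl rewrite +-identityʳ j = refl
modifyAt-++ (x ∷ pre) xs j g refl rewrite +-suc j (length pre) = cong (x ∷_) (modifyAt-++ pre xs j g refl)

take-++ : ∀ {A : Set} (pre xs : List A) {k} j → length pre ≡ k → take (j + k) (pre ++ xs) ≡ pre ++ take j xs
take-++ []        xs j refl rewrite +-identityʳ j = refl
take-++ (x ∷ pre) xs j refl rewrite +-suc j (length pre) = cong (x ∷_) (take-++ pre xs j refl)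

!!-modifyAt : ∀ {A : Set} (xs : List A) i (g : A → A) → modifyAt i g xs !! i ≡ Maybe.map g (xs !! i)
!!-modifyAt []       i       g = refl
!!-modifyAt (x ∷ xs) zero    g = refl
!!-modifyAt (x ∷ xs) (suc i) g = !!-modifyAt xs i g

!!-modifyAt-≢ : ∀ {A : Set} (xs : List A) i (g : A → A) {k} → k ≢ i → modifyAt i g xs !! k ≡ xs !! k
!!-modifyAt-≢ []       i       g         k≢i = refl
!!-modifyAt-≢ (x ∷ xs) zero    g {zero}  k≢i = contradiction refl k≢i
!!-modifyAt-≢ (x ∷ xs) zero    g {suc k} k≢i = refl
!!-modifyAt-≢ (x ∷ xs) (suc i) g {zero}  k≢i = refl
!!-modifyAt-≢ (x ∷ xs) (suc i) g {suc k} k≢i = !!-modifyAt-≢ xs i g (k≢i ∘ cong suc)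

unique-suffix : ∀ {A : Set} {vs : List A} us → Unique (us ++ vs) → Unique vs
unique-suffix []       uniq       = uniq
unique-suffix (u ∷ us) (_ ∷ uniq) = unique-suffix us uniq

unique⇒∉-prefix : ∀ {A : Set} us {x : A} {rest} → Unique (us ++ x ∷ rest) → x ∉ us
unique⇒∉-prefix (u ∷ us) (u≢ ∷ _)    (here refl) = All.lookup u≢ (∈-++⁺ʳ us (here refl)) refl
unique⇒∉-prefix (u ∷ us) (_ ∷ uniq) (there x∈) = unique⇒∉-prefix us uniq x∈

linked-suffix : ∀ {A : Set} {R : A → A → Set} us {vs} → Linked R (us ++ vs) → Linked R vs
linked-suffix []       linked = linked
linked-suffix (u ∷ us) linked = linked-suffix us (Linked.tail linked)


cell-!! : ∀ S i c → cell S i c ≡ (S !! i >>= λ r → join (r !! c))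
cell-!! S i c with S !! i
... | nothing = refl
... | just r with r !! c
...   | just (just v) = refl
...   | just nothing  = refl
...   | nothing       = refl

cell-++ : ∀ pre S {k} i c → length pre ≡ k → cell (pre ++ S) (i + k) c ≡ cell S i c
cell-++ pre S {k} i c eq = begin
  cell (pre ++ S) (i + k) c                          ≡⟨ cell-!! (pre ++ S) (i + k) c ⟩
  ((pre ++ S) !! (i + k) >>= λ r → join (r !! c)) ≡⟨ cong (_>>= λ r → join (r !! c)) (!!-++ pre S i eq) ⟩
  (S !! i >>= λ r → join (r !! c))                 ≡⟨ cell-!! S i c ⟨
  cell S i c                                         ∎
  where open ≡-Reasoning

Occurs : ℕ → ℕ → Tab → Set
Occurs x k S = ∃[ r ] S !! k ≡ just r × x ∈ filled r

InRowsUpTo : ℕ → ℕ → Tab → Set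
InRowsUpTo x R S = ∀ k → Occurs x k S → k ≤ R

∈-filled-!! : ∀ (r : Row) c {v} → join (r !! c) ≡ just v → v ∈ filled r
∈-filled-!! (nothing ∷ r) zero    ()
∈-filled-!! (just u ∷ r)  zero    refl = here refl
∈-filled-!! (nothing ∷ r) (suc c) e    = ∈-filled-!! r c e
∈-filled-!! (just u ∷ r)  (suc c) e    = there (∈-filled-!! r c e)

cell⇒Occurs : ∀ S i c {v} → cell S i c ≡ just v → Occurs v i S
cell⇒Occurs S i c e = occurs (S !! i) refl (trans (sym (cell-!! S i c)) e)
  where
  occurs : ∀ {v} m → S !! i ≡ m → (m >>= λ r → join (r !! c)) ≡ just v → Occurs v i S
  occurs (just r) eq e′ = r , eq , ∈-filled-!! r c e′

∈-filled-∷ : ∀ {x} u {r : Row} → x ∈ filled r → x ∈ filled (u ∷ r)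
∈-filled-∷ nothing  x∈ = x∈
∈-filled-∷ (just v) x∈ = there x∈

∈-filled-take : ∀ {x} c (r : Row) → x ∈ filled (take c r) → x ∈ filled r
∈-filled-take (suc c) (nothing ∷ r) x∈         = ∈-filled-take c r x∈
∈-filled-take (suc c) (just v ∷ r)  (here refl) = here refl
∈-filled-take (suc c) (just v ∷ r)  (there x∈)  = there (∈-filled-take c r x∈)

∈-filled-set : ∀ {x} c y (r : Row) → x ∈ filled (modifyAt c (λ _ → y) r) → x ∈ filled r ⊎ y ≡ just x
∈-filled-set zero    nothing  (u ∷ r)      x∈          = inj₁ (∈-filled-∷ u x∈)
∈-filled-set zero    (just v) (u ∷ r)      (here refl) = inj₂ refl
∈-filled-set zero    (just v) (u ∷ r)      (there x∈)  = inj₁ (∈-filled-∷ u x∈)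
∈-filled-set (suc c) y        (nothing ∷ r) x∈         = ∈-filled-set c y r x∈
∈-filled-set (suc c) y        (just v ∷ r) (here refl) = inj₁ (here refl)
∈-filled-set (suc c) y        (just v ∷ r) (there x∈)  = Sum.map₁ there (∈-filled-set c y r x∈)


-- Jeu de taquin never moves an entry down

module _ {x R : ℕ} where

  InRowsUpTo-modifyAt : ∀ S i (g : Row → Row) → InRowsUpTo x R S →
    (∀ {r} → x ∈ filled (g r) → x ∈ filled r ⊎ i ≤ R) → InRowsUpTo x R (modifyAt i g S)
  InRowsUpTo-modifyAt S i g bound new k (r′ , eq , x∈) with k ≟ i
  ... | no k≢i = bound k (r′ , trans (sym (!!-modifyAt-≢ S i g k≢i)) eq , x∈)
  ... | yes refl with S !! k in eqS | trans (sym (!!-modifyAt S k g)) eq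
  ...   | nothing | ()
  ...   | just r  | refl with new x∈
  ...     | inj₁ x∈r = bound k (r , eqS , x∈r)
  ...     | inj₂ k≤R = k≤R

  InRowsUpTo-setCell : ∀ S i c y → InRowsUpTo x R S → (y ≡ just x → i ≤ R) → InRowsUpTo x R (setCell i c y S)
  InRowsUpTo-setCell S i c y bound new = InRowsUpTo-modifyAt S i _ bound λ {r} → Sum.map₂ new ∘ ∈-filled-set c y r

  InRowsUpTo-trim : ∀ S i c → InRowsUpTo x R S → InRowsUpTo x R (modifyAt i (take c) S)
  InRowsUpTo-trim S i c bound = InRowsUpTo-modifyAt S i (take c) bound λ {r} → inj₁ ∘ ∈-filled-take c r

  InRowsUpTo-move : ∀ S i c i′ c′ {v} → cell S i′ c′ ≡ just v → i ≤ i′ → InRowsUpTo x R S →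
    InRowsUpTo x R (setCell i′ c′ nothing (setCell i c (just v) S))
  InRowsUpTo-move S i c i′ c′ {v} e i≤i′ bound =
    InRowsUpTo-setCell (setCell i c (just v) S) i′ c′ nothing
      (InRowsUpTo-setCell S i c (just v) bound λ { refl → ≤-trans i≤i′ (bound i′ (cell⇒Occurs S i′ c′ e)) })
      λ ()

  InRowsUpTo-slide : ∀ f i c S → InRowsUpTo x R S → InRowsUpTo x R (slide f i c S)
  InRowsUpTo-slide zero    i c S bound = bound
  InRowsUpTo-slide (suc f) i c S bound with cell S i (suc c) in right | cell S (suc i) c in below
  ... | nothing | nothing = InRowsUpTo-trim S i c bound
  ... | just r  | nothing = InRowsUpTo-slide f i (suc c) _ (InRowsUpTo-move S i c i (suc c) right ≤-refl bound)
  ... | nothing | just b  = InRowsUpTo-slide f (suc i) c _ (InRowsUpTo-move S i c (suc i) c below (n≤1+n i) bound)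
  ... | just r  | just b with r <ᵇ b
  ...   | true  = InRowsUpTo-slide f i (suc c) _ (InRowsUpTo-move S i c i (suc c) right ≤-refl bound)
  ...   | false = InRowsUpTo-slide f (suc i) c _ (InRowsUpTo-move S i c (suc i) c below (n≤1+n i) bound)

  InRowsUpTo-rectify : ∀ f S → InRowsUpTo x R S → InRowsUpTo x R (rectify f S)
  InRowsUpTo-rectify zero    S bound = bound
  InRowsUpTo-rectify (suc f) S bound with lastCorner 0 S
  ... | nothing      = bound
  ... | just (i , c) = InRowsUpTo-rectify f _ (InRowsUpTo-slide (suc (size S)) i c S bound)

InRowsUpTo-++ : ∀ {x R} pre {S} → InRowsUpTo x R S → InRowsUpTo x (length pre + R) (pre ++ S)
InRowsUpTo-++ []        bound = bound
InRowsUpTo-++ (r ∷ pre) bound zero    _   = z≤n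
InRowsUpTo-++ (r ∷ pre) bound (suc k) occ = s≤s (InRowsUpTo-++ pre bound k occ)


move-++ : ∀ pre S i c i′ c′ v →
  setCell (i′ + length pre) c′ nothing (setCell (i + length pre) c (just v) (pre ++ S))
    ≡ pre ++ setCell i′ c′ nothing (setCell i c (just v) S)
move-++ pre S i c i′ c′ v
  rewrite modifyAt-++ pre S i (modifyAt c λ _ → just v) refl = modifyAt-++ pre _ i′ _ refl

slide-++ : ∀ f pre S i c → slide f (i + length pre) c (pre ++ S) ≡ pre ++ slide f i c S
slide-++ zero    pre S i c = refl
slide-++ (suc f) pre S i c
  rewrite cell-++ pre S i (suc c) refl | cell-++ pre S (suc i) c refl
  with cell S i (suc c) | cell S (suc i) c
... | nothing | nothing = modifyAt-++ pre S i (take c) refl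
... | just r  | nothing rewrite move-++ pre S i c i (suc c) r = slide-++ f pre _ i (suc c)
... | nothing | just b  rewrite move-++ pre S i c (suc i) c b = slide-++ f pre _ (suc i) c
... | just r  | just b with r <ᵇ b
...   | true  rewrite move-++ pre S i c i (suc c) r = slide-++ f pre _ i (suc c)
...   | false rewrite move-++ pre S i c (suc i) c b = slide-++ f pre _ (suc i) c

slide-left : ∀ {f i c r} S → cell S i (suc c) ≡ just r → cell S (suc i) c ≡ nothing →
  slide (suc f) i c S ≡ slide f i (suc c) (setCell i (suc c) nothing (setCell i c (just r) S))
slide-left S right below rewrite right | below = refl

slide-end : ∀ {f i c} S → cell S i (suc c) ≡ nothing → cell S (suc i) c ≡ nothing →
  slide (suc f) i c S ≡ modifyAt i (take c) S
slide-end S right below rewrite right | below = refl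

rectify-step : ∀ f S {i c} → lastCorner 0 S ≡ just (i , c) → rectify (suc f) S ≡ rectify f (slide (suc (size S)) i c S)
rectify-step f S corner rewrite corner = refl


-- Staircases

shifted : ℕ → ℕ → Row
shifted k a = replicate k nothing ∷ʳ just a

column : List ℕ → Tab
column = map λ b → just b ∷ []

staircase : ℕ → List ℕ → Tab
staircase m []       = []
staircase m (a ∷ as) = shifted (m + length as) a ∷ staircase m as

cell-column-suc : ∀ bs i c → cell (column bs) i (suc c) ≡ nothing
cell-column-suc []       i       c = refl
cell-column-suc (b ∷ bs) zero    c = refl
cell-column-suc (b ∷ bs) (suc i) c = cell-column-suc bs i c

slide-shift : ∀ f c a bs →
  slide (suc (suc f)) 0 (suc c) (shifted (suc (suc c)) a ∷ column bs) ≡ shifted (suc c) a ∷ column bs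
slide-shift f c a bs = begin
  slide (suc (suc f)) 0 (suc c) (shifted (suc (suc c)) a ∷ column bs)
    ≡⟨ cong (λ r → slide (suc (suc f)) 0 (suc c) (r ∷ column bs)) (replicate-∷ʳ (suc c) nothing (just a)) ⟩
  slide (suc (suc f)) 0 (suc c) X₀
    ≡⟨ slide-left {i = 0} X₀ (entry 1 (nothing ∷ just a ∷ [])) (cell-column-suc bs 0 c) ⟩
  slide (suc f) 0 (suc (suc c)) (setCell 0 (suc (suc c)) nothing (setCell 0 (suc c) (just a) X₀))
    ≡⟨ cong (λ r → slide (suc f) 0 (suc (suc c)) (r ∷ column bs)) moved ⟩
  slide (suc f) 0 (suc (suc c)) X₁
    ≡⟨ slide-end {i = 0} X₁ (entry 2 (just a ∷ nothing ∷ [])) (cell-column-suc bs 0 (suc c)) ⟩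
  take (suc (suc c)) (P ++ just a ∷ nothing ∷ []) ∷ column bs
    ≡⟨ cong (_∷ column bs) (take-++ P _ 1 (length-replicate (suc c))) ⟩
  shifted (suc c) a ∷ column bs
    ∎
  where
  open ≡-Reasoning
  P = replicate (suc c) nothing
  X₀ = (P ++ nothing ∷ just a ∷ []) ∷ column bs
  X₁ = (P ++ just a ∷ nothing ∷ []) ∷ column bs
  entry : ∀ j ys → cell ((P ++ ys) ∷ column bs) 0 (j + suc c) ≡ join (ys !! j)
  entry j ys = trans (cell-!! ((P ++ ys) ∷ column bs) 0 (j + suc c))
                     (cong join (!!-++ P ys j (length-replicate (suc c))))
  moved : modifyAt (suc (suc c)) (λ _ → nothing) (modifyAt (suc c) (λ _ → just a) (P ++ nothing ∷ just a ∷ []))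
    ≡ P ++ just a ∷ nothing ∷ []
  moved = trans (cong (modifyAt (suc (suc c)) λ _ → nothing)
                      (modifyAt-++ P (nothing ∷ just a ∷ []) 0 (λ _ → just a) (length-replicate (suc c))))
                (modifyAt-++ P (just a ∷ just a ∷ []) 1 (λ _ → nothing) (length-replicate (suc c)))

<ᵇ≡true : ∀ {m n} → m < n → (m <ᵇ n) ≡ true
<ᵇ≡true m<n = Equivalence.to T-≡ (<⇒<ᵇ m<n)

<ᵇ≡false : ∀ {m n} → n ≤ m → (m <ᵇ n) ≡ false
<ᵇ≡false {m} {n} n≤m with m <ᵇ n in eq
... | true  = contradiction (<ᵇ⇒< m n (Equivalence.from T-≡ eq)) (≤⇒≯ n≤m)
... | false = refl

slide-merge : ∀ {f a b} bs → a < b →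
  slide (suc (suc f)) 0 0 (shifted 1 a ∷ column (b ∷ bs)) ≡ column (a ∷ b ∷ bs)
slide-merge bs a<b rewrite <ᵇ≡true a<b = refl

slide-descent : ∀ {f a b} bs → b ≤ a →
  slide (suc (suc f)) 0 0 (shifted 1 a ∷ column (b ∷ bs))
    ≡ slide (suc f) 1 0 ((just b ∷ just a ∷ []) ∷ (nothing ∷ []) ∷ column bs)
slide-descent bs b≤a rewrite <ᵇ≡false b≤a = refl

Occurs-column⇒∈ : ∀ {x} bs k → Occurs x k (column bs) → x ∈ bs
Occurs-column⇒∈ (b ∷ bs) zero    (_ , refl , here refl) = here refl
Occurs-column⇒∈ (b ∷ bs) (suc k) occ                   = there (Occurs-column⇒∈ bs k occ)

InRowsUpTo-descent : ∀ {a b} bs → b ∉ bs → InRowsUpTo b 0 ((just b ∷ just a ∷ []) ∷ (nothing ∷ []) ∷ column bs)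
InRowsUpTo-descent bs b∉bs zero          _              = z≤n
InRowsUpTo-descent bs b∉bs (suc zero)    (_ , refl , ())
InRowsUpTo-descent bs b∉bs (suc (suc k)) occ            = contradiction (Occurs-column⇒∈ bs k occ) b∉bs

size-++ : ∀ S S′ → size (S ++ S′) ≡ size S + size S′
size-++ S S′ = trans (cong sum (map-++ _ S S′)) (sum-++ (map (length ∘ filled) S) _)

innerSize-++ : ∀ S S′ → innerSize (S ++ S′) ≡ innerSize S + innerSize S′
innerSize-++ S S′ = trans (cong sum (map-++ innerLen S S′)) (sum-++ (map innerLen S) _)

filled-shifted : ∀ k a → filled (shifted k a) ≡ [ a ]
filled-shifted zero    a = refl
filled-shifted (suc k) a = filled-shifted k a

innerLen-shifted : ∀ k a → innerLen (shifted k a) ≡ k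
innerLen-shifted zero    a = refl
innerLen-shifted (suc k) a = cong suc (innerLen-shifted k a)

size-around-shifted : ∀ pre k a S → size (pre ++ shifted k a ∷ S) ≡ suc (size pre + size S)
size-around-shifted pre k a S = begin
  size (pre ++ shifted k a ∷ S)                          ≡⟨ size-++ pre _ ⟩
  size pre + (length (filled (shifted k a)) + size S)  ≡⟨ cong (λ r → size pre + (length r + size S)) (filled-shifted k a) ⟩
  size pre + suc (size S)                                ≡⟨ +-suc (size pre) (size S) ⟩
  suc (size pre + size S)                                ∎
  where open ≡-Reasoning

lastCorner-column : ∀ i bs → lastCorner i (column bs) ≡ nothing
lastCorner-column i []       = refl
lastCorner-column i (b ∷ bs) rewrite lastCorner-column (suc i) bs = refl

lastCorner-shifted : ∀ i c a bs → lastCorner i (shifted (suc c) a ∷ column bs) ≡ just (i , c)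
lastCorner-shifted i c a bs rewrite lastCorner-column (suc i) bs | innerLen-shifted c a = refl

lastCorner-++ : ∀ pre {S q} i → lastCorner (i + length pre) S ≡ just q → lastCorner i (pre ++ S) ≡ just q
lastCorner-++ []        {S} i corner = subst (λ j → lastCorner j S ≡ _) (+-identityʳ i) corner
lastCorner-++ (r ∷ pre) {S} {q} i corner
  rewrite lastCorner-++ pre {S} (suc i) (subst (λ j → lastCorner j S ≡ just q) (+-suc i (length pre)) corner) = refl

rectify-column : ∀ f bs → rectify f (column bs) ≡ column bs
rectify-column zero    bs = refl
rectify-column (suc f) bs rewrite lastCorner-column 0 bs = refl

rectify-step-shifted : ∀ f pre c a bs →
  rectify (suc f) (pre ++ shifted (suc c) a ∷ column bs)
    ≡ rectify f (pre ++ slide (suc (suc (size pre + size (column bs)))) 0 c (shifted (suc c) a ∷ column bs))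
rectify-step-shifted f pre c a bs = begin
  rectify (suc f) S
    ≡⟨ rectify-step f S (lastCorner-++ pre {X} 0 (lastCorner-shifted (length pre) c a bs)) ⟩
  rectify f (slide (suc (size S)) (length pre) c S)
    ≡⟨ cong (λ s → rectify f (slide (suc s) (length pre) c S)) (size-around-shifted pre (suc c) a (column bs)) ⟩
  rectify f (slide (suc (suc K)) (length pre) c S)
    ≡⟨ cong (rectify f) (slide-++ _ pre X 0 c) ⟩
  rectify f (pre ++ slide (suc (suc K)) 0 c X)
    ∎
  where
  open ≡-Reasoning
  X = shifted (suc c) a ∷ column bs
  S = pre ++ X
  K = size pre + size (column bs)

rectify-shift : ∀ c f pre a bs →
  rectify (c + f) (pre ++ shifted (suc c) a ∷ column bs) ≡ rectify f (pre ++ shifted 1 a ∷ column bs)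
rectify-shift zero    f pre a bs = refl
rectify-shift (suc c) f pre a bs = begin
  rectify (suc (c + f)) (pre ++ shifted (suc (suc c)) a ∷ column bs)
    ≡⟨ rectify-step-shifted (c + f) pre (suc c) a bs ⟩
  rectify (c + f) (pre ++ slide _ 0 (suc c) (shifted (suc (suc c)) a ∷ column bs))
    ≡⟨ cong (λ S → rectify (c + f) (pre ++ S)) (slide-shift _ c a bs) ⟩
  rectify (c + f) (pre ++ shifted (suc c) a ∷ column bs)
    ≡⟨ rectify-shift c f pre a bs ⟩
  rectify f (pre ++ shifted 1 a ∷ column bs)
    ∎
  where open ≡-Reasoning

rectify-merge : ∀ f pre {a b} bs → a < b →
  rectify (suc f) (pre ++ shifted 1 a ∷ column (b ∷ bs)) ≡ rectify f (pre ++ column (a ∷ b ∷ bs))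
rectify-merge f pre bs a<b =
  trans (rectify-step-shifted f pre 0 _ (_ ∷ bs)) (cong (λ S → rectify f (pre ++ S)) (slide-merge bs a<b))

rectify-descent : ∀ f pre {a b} bs → b ≤ a → b ∉ bs →
  InRowsUpTo b (length pre) (rectify (suc f) (pre ++ shifted 1 a ∷ column (b ∷ bs)))
rectify-descent f pre {a} {b} bs b≤a b∉bs
  rewrite rectify-step-shifted f pre 0 a (b ∷ bs) | slide-descent {size pre + size (column (b ∷ bs))} bs b≤a =
  InRowsUpTo-rectify f _
    (subst (λ R → InRowsUpTo b R (pre ++ S)) (+-identityʳ (length pre))
      (InRowsUpTo-++ pre (InRowsUpTo-slide F 1 0 X (InRowsUpTo-descent bs b∉bs))))
  where
  F = suc (size pre + size (column (b ∷ bs)))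
  X = (just b ∷ just a ∷ []) ∷ (nothing ∷ []) ∷ column bs
  S = slide F 1 0 X

-- In the staircase of us ++ y ∷ x ∷ rest, the entry x lies in row length us + 1.
data Outcome (vs : List ℕ) (R : Tab) : Set where
  ascending : Linked _<_ vs → R ≡ column vs → Outcome vs R
  descent   : ∀ us {y x} rest → vs ≡ us ++ y ∷ x ∷ rest → x ≤ y → InRowsUpTo x (length us) R → Outcome vs R

staircase-∷ʳ : ∀ m as a → staircase m (as ∷ʳ a) ≡ staircase (suc m) as ++ shifted m a ∷ []
staircase-∷ʳ m []       a = cong (λ k → shifted k a ∷ []) (+-identityʳ m)
staircase-∷ʳ m (x ∷ as) a = cong₂ _∷_ (cong (λ k → shifted k x) indent) (staircase-∷ʳ m as a)
  where
  indent : m + length (as ∷ʳ a) ≡ suc m + length as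
  indent = trans (cong (m +_) (trans (length-++ as) (+-comm (length as) 1))) (+-suc m (length as))

length-staircase : ∀ m as → length (staircase m as) ≡ length as
length-staircase m []       = refl
length-staircase m (a ∷ as) = cong suc (length-staircase m as)

innerSize-staircase-∷ʳ : ∀ m as a → innerSize (staircase m (as ∷ʳ a)) ≡ innerSize (staircase (suc m) as) + m
innerSize-staircase-∷ʳ m as a = begin
  innerSize (staircase m (as ∷ʳ a))                         ≡⟨ cong innerSize (staircase-∷ʳ m as a) ⟩
  innerSize (staircase (suc m) as ++ shifted m a ∷ [])      ≡⟨ innerSize-++ (staircase (suc m) as) _ ⟩
  innerSize (staircase (suc m) as) + (innerLen (shifted m a) + 0) ≡⟨ cong (innerSize (staircase (suc m) as) +_) (trans (+-identityʳ _) (innerLen-shifted m a)) ⟩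
  innerSize (staircase (suc m) as) + m                      ∎
  where open ≡-Reasoning

fuel-split : ∀ {i c f} → i + suc c ≤ f → ∃[ f′ ] f ≡ c + suc f′ × i ≤ f′
fuel-split {i} {c} i+1+c≤f with d , refl ← m≤n⇒∃[o]m+o≡n i+1+c≤f = i + d , rearrange i c d , m≤m+n i d
  where
  rearrange : ∀ i c d → i + suc c + d ≡ c + suc (i + d)
  rearrange = solve-∀

-- Rows are rectified bottom-up: the entries as above are still a staircase,
-- the entries b ∷ bs below already form a column.
rectify-staircase : ∀ {as} → Reverse as → ∀ b bs → Unique (as ++ b ∷ bs) → Linked _<_ (b ∷ bs) →
  ∀ f → innerSize (staircase (suc (length bs)) as) ≤ f →
  Outcome (as ++ b ∷ bs) (rectify f (staircase (suc (length bs)) as ++ column (b ∷ bs)))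
rectify-staircase [] b bs _ asc f _ = ascending asc (rectify-column f (b ∷ bs))
rectify-staircase (as ∶ rest ∶ʳ a) b bs uniq asc f fuel
  with f′ , refl , fuel′ ← fuel-split (subst (_≤ f) (innerSize-staircase-∷ʳ _ as a) fuel)
  rewrite staircase-∷ʳ (suc (length bs)) as a
        | ++-assoc (staircase (suc (suc (length bs))) as) [ shifted (suc (length bs)) a ] (column (b ∷ bs))
        | ++-assoc as [ a ] (b ∷ bs)
        | rectify-shift (length bs) (suc f′) (staircase (suc (suc (length bs))) as) a (b ∷ bs)
  with a <? b
... | yes a<b rewrite rectify-merge f′ (staircase (suc (suc (length bs))) as) bs a<b =
  rectify-staircase rest a (b ∷ bs) uniq (a<b ∷ asc) f′ fuel′
... | no a≮b = descent as bs refl (≮⇒≥ a≮b)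
  (subst (λ k → InRowsUpTo b k (rectify (suc f′) (staircase (suc (suc (length bs))) as ++ shifted 1 a ∷ column (b ∷ bs))))
     (length-staircase _ as)
    (rectify-descent f′ (staircase (suc (suc (length bs))) as) bs (≮⇒≥ a≮b)
      (Unique[x∷xs]⇒x∉xs (unique-suffix [ a ] (unique-suffix as uniq)))))

Rect-staircase : ∀ vs → Unique vs → Outcome vs (Rect (staircase 0 vs))
Rect-staircase vs uniq with reverseView vs
... | []              = ascending [] refl
... | as ∶ rest ∶ʳ v rewrite staircase-∷ʳ 0 as v =
  rectify-staircase rest v [] uniq [-] _
    (subst (innerSize (staircase 1 as) ≤_) (sym (innerSize-++ (staircase 1 as) _)) (m≤m+n _ _))


-- Stabilization at 1

any-≡ᵇ⇒∈ : ∀ {x} xs → any (λ v → v ≡ᵇ x) xs ≡ true → x ∈ xs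
any-≡ᵇ⇒∈ {x} xs found = Any.map (sym ∘ ≡ᵇ⇒≡ _ x) (any⁻ _ xs (Equivalence.from T-≡ found))

≢⇒≡ᵇ≡false : ∀ {m n} → m ≢ n → (m ≡ᵇ n) ≡ false
≢⇒≡ᵇ≡false {m} {n} m≢n with m ≡ᵇ n in eq
... | true  = contradiction (≡ᵇ⇒≡ m n (Equivalence.from T-≡ eq)) m≢n
... | false = refl

rowOf⇒Occurs : ∀ x S {k} → rowOf x S ≡ just k → Occurs x k S
rowOf⇒Occurs x (r ∷ S) e with any (λ v → v ≡ᵇ x) (filled r) in found
... | true with refl ← e = r , refl , any-≡ᵇ⇒∈ (filled r) found
... | false with rowOf x S in below | e
...   | just k | refl = rowOf⇒Occurs x S below

rowOf-filled : ∀ x {S S′} → map filled S ≡ map filled S′ → rowOf x S ≡ rowOf x S′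
rowOf-filled x {[]}    {[]}     _ = refl
rowOf-filled x {r ∷ S} {r′ ∷ S′} e with ∷-injective e
... | same-row , same-rest rewrite same-row | rowOf-filled x same-rest = refl

rowOf-column : ∀ {x} us rest → x ∉ us → rowOf x (column (us ++ x ∷ rest)) ≡ just (length us)
rowOf-column {x} []       rest _ rewrite Equivalence.to T-≡ (≡⇒≡ᵇ x x refl) = refl
rowOf-column {x} (u ∷ us) rest x∉
  rewrite ≢⇒≡ᵇ≡false (x∉ ∘ here ∘ sym) | rowOf-column us rest (x∉ ∘ there) = refl

power-1 : ∀ S → power 1 S ≡ S
power-1 S = trans (map-cong ++-identityʳ S) (map-id S)

StabIs-1⇔StabilizesAt : ∀ S → StabIs S 1 ⇔ StabilizesAt S 1
StabIs-1⇔StabilizesAt S = mk⇔ (λ (_ , stable , _) → stable)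
  λ stable → ≤-refl , stable , λ j 1≤j j<1 → contradiction 1≤j (<⇒≱ j<1)

rows-kept⇒stable : ∀ S → (∀ x → rowOf x (Rect S) ≡ rowOf x S) → StabilizesAt S 1
rows-kept⇒stable S kept x _ _ rewrite power-1 S = kept x

moved-up⇒unstable : ∀ S {x k} → 1 ≤ x → x ≤ size S → rowOf x S ≡ just (suc k) →
  InRowsUpTo x k (Rect S) → ¬ StabilizesAt S 1
moved-up⇒unstable S {x} {k} 1≤x x≤size row bound stable =
  1+n≰n (bound (suc k) (rowOf⇒Occurs x (Rect S) (trans rect-row row)))
  where
  rect-row : rowOf x (Rect S) ≡ rowOf x S
  rect-row = subst (λ S′ → rowOf x (Rect S′) ≡ rowOf x S′) (power-1 S)
    (stable x 1≤x (subst (x ≤_) (sym (+-identityʳ (size S))) x≤size))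

size-staircase : ∀ m vs → size (staircase m vs) ≡ length vs
size-staircase m []       = refl
size-staircase m (a ∷ vs) rewrite filled-shifted (m + length vs) a = cong suc (size-staircase m vs)

filled-staircase : ∀ m vs → map filled (staircase m vs) ≡ map filled (column vs)
filled-staircase m []       = refl
filled-staircase m (a ∷ vs) = cong₂ _∷_ (filled-shifted (m + length vs) a) (filled-staircase m vs)

staircase-stable⇔ascending : ∀ {vs} → Unique vs → (∀ {x} → x ∈ vs → 1 ≤ x × x ≤ length vs) →
  StabilizesAt (staircase 0 vs) 1 ⇔ Linked _<_ vs
staircase-stable⇔ascending {vs} uniq bounded = characterise (Rect-staircase vs uniq)
  where
  S = staircase 0 vs
  characterise : Outcome vs (Rect S) → StabilizesAt S 1 ⇔ Linked _<_ vs
  characterise (ascending asc rect≡column) = mk⇔ (λ _ → asc) λ _ → rows-kept⇒stable S λ x →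
    trans (cong (rowOf x) rect≡column) (rowOf-filled x (sym (filled-staircase 0 vs)))
  characterise (descent us {y} {x} rest split x≤y bound) =
    mk⇔ (λ stable → contradiction stable (moved-up⇒unstable S 1≤x x≤size row bound))
        (λ asc → contradiction x≤y (<⇒≱ (Linked.head (linked-suffix us (subst (Linked _<_) split asc)))))
    where
    split′ : vs ≡ (us ++ [ y ]) ++ x ∷ rest
    split′ = trans split (sym (++-assoc us [ y ] (x ∷ rest)))
    x-bounds : 1 ≤ x × x ≤ length vs
    x-bounds = bounded (subst (x ∈_) (sym split) (∈-++⁺ʳ us (there (here refl))))
    1≤x : 1 ≤ x
    1≤x = proj₁ x-bounds
    x≤size : x ≤ size S
    x≤size = subst (x ≤_) (sym (size-staircase 0 vs)) (proj₂ x-bounds)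
    row : rowOf x S ≡ just (suc (length us))
    row = begin
      rowOf x S
        ≡⟨ rowOf-filled x (filled-staircase 0 vs) ⟩
      rowOf x (column vs)
        ≡⟨ cong (rowOf x ∘ column) split′ ⟩
      rowOf x (column ((us ++ [ y ]) ++ x ∷ rest))
        ≡⟨ rowOf-column (us ++ [ y ]) rest (unique⇒∉-prefix (us ++ [ y ]) (subst Unique split′ uniq)) ⟩
      just (length (us ++ [ y ]))
        ≡⟨ cong just (trans (length-++ us) (+-comm (length us) 1)) ⟩
      just (suc (length us))
        ∎
      where open ≡-Reasoning


ascending-length≤ : ∀ {n l u} (g : Fin n → ℕ) → Linked _<_ (l ∷ tabulate g) → l ≤ u → (∀ i → g i ≤ u) → n + l ≤ u
ascending-length≤ {zero}          g _             l≤u _     = l≤u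
ascending-length≤ {suc n} {l} {u} g (l<g₀ ∷ asc) l≤u bound = begin
  suc n + l      ≡⟨ +-suc n l ⟨
  n + suc l      ≤⟨ +-monoʳ-≤ n l<g₀ ⟩
  n + g fzero    ≤⟨ ascending-length≤ (g ∘ fsuc) asc (bound fzero) (bound ∘ fsuc) ⟩
  u              ∎
  where open ≤-Reasoning

ascending⇒consecutive : ∀ {n} l (g : Fin n → ℕ) → Linked _<_ (l ∷ tabulate g) → (∀ i → g i ≤ l + n) →
  ∀ i → g i ≡ l + suc (toℕ i)
ascending⇒consecutive {suc n} l g (l<g₀ ∷ asc) bound with m≤n⇒m<n∨m≡n l<g₀
... | inj₂ g₀≡1+l = λ
  { fzero    → trans (sym g₀≡1+l) (+-comm 1 l)
  ; (fsuc i) → trans (ascending⇒consecutive (suc l) (g ∘ fsuc) asc′ bound′ i) (sym (+-suc l (suc (toℕ i))))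
  }
  where
  asc′ : Linked _<_ (suc l ∷ tabulate (g ∘ fsuc))
  asc′ = subst (λ h → Linked _<_ (h ∷ tabulate (g ∘ fsuc))) (sym g₀≡1+l) asc
  bound′ : ∀ j → g (fsuc j) ≤ suc l + n
  bound′ j = subst (g (fsuc j) ≤_) (+-suc l n) (bound (fsuc j))
... | inj₁ 1+l<g₀ = contradiction (begin
  suc (l + suc n)      ≡⟨ rearrange l n ⟩
  n + suc (suc l)      ≤⟨ +-monoʳ-≤ n 1+l<g₀ ⟩
  n + g fzero          ≤⟨ ascending-length≤ (g ∘ fsuc) asc (bound fzero) (bound ∘ fsuc) ⟩
  l + suc n            ∎) (n≮n (l + suc n))
  where
  open ≤-Reasoning
  rearrange : ∀ l n → suc (l + suc n) ≡ n + suc (suc l)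
  rearrange = solve-∀

consecutive⇒ascending : ∀ {n} l (g : Fin n → ℕ) → (∀ i → g i ≡ l + suc (toℕ i)) → Linked _<_ (l ∷ tabulate g)
consecutive⇒ascending {zero}  l g _    = [-]
consecutive⇒ascending {suc n} l g cons =
  subst (l <_) (sym (cons fzero)) (m<m+n l z<s) ∷ consecutive⇒ascending (g fzero) (g ∘ fsuc) cons′
  where
  cons′ : ∀ i → g (fsuc i) ≡ g fzero + suc (toℕ i)
  cons′ i = trans (cons (fsuc i)) (trans (sym (+-assoc l 1 (suc (toℕ i)))) (cong (_+ suc (toℕ i)) (sym (cons fzero))))


-- The staircase of a permutation

topToBottom : ∀ {n} → Permutation′ n → List ℕ
topToBottom w = tabulate λ i → suc (toℕ (w ⟨$⟩ʳ opposite i))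

tabulate-staircase : ∀ {n} (g : Fin n → ℕ) → tabulate (λ i → shifted (toℕ (opposite i)) (g i)) ≡ staircase 0 (tabulate g)
tabulate-staircase {zero}  g = refl
tabulate-staircase {suc n} g = cong₂ _∷_
  (cong (λ k → shifted k (g fzero)) (trans (opposite-prop {suc n} fzero) (sym (length-tabulate (g ∘ fsuc)))))
  (trans (tabulate-cong λ i → cong (λ k → shifted k (g (fsuc i))) (opposite-suc i)) (tabulate-staircase (g ∘ fsuc)))

T≡staircase : ∀ {n} (w : Permutation′ n) → T w ≡ staircase 0 (topToBottom w)
T≡staircase w = tabulate-staircase _

opposite-injective : ∀ {n} {i j : Fin n} → opposite i ≡ opposite j → i ≡ j
opposite-injective {i = i} {j} e = trans (sym (opposite-involutive i)) (trans (cong opposite e) (opposite-involutive j))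

topToBottom-unique : ∀ {n} (w : Permutation′ n) → Unique (topToBottom w)
topToBottom-unique w = tabulate⁺ λ e → opposite-injective (Injection.injective (↔⇒↣ w) (toℕ-injective (suc-injective e)))

topToBottom-bounded : ∀ {n} (w : Permutation′ n) {x} → x ∈ topToBottom w → 1 ≤ x × x ≤ length (topToBottom w)
topToBottom-bounded w x∈ with i , refl ← ∈-tabulate⁻ x∈ =
  s≤s z≤n , subst (suc (toℕ (w ⟨$⟩ʳ opposite i)) ≤_) (sym (length-tabulate _)) (toℕ<n (w ⟨$⟩ʳ opposite i))

reversal⇔ascending : ∀ {n} (w : Permutation′ n) → (∀ i → w ⟨$⟩ʳ i ≡ opposite i) ⇔ Linked _<_ (topToBottom w)
reversal⇔ascending {n} w = mk⇔ reversal⇒ascending ascending⇒reversal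
  where
  g : Fin n → ℕ
  g i = suc (toℕ (w ⟨$⟩ʳ opposite i))
  positive-head : ∀ {m} {h : Fin m → ℕ} → Linked _<_ (tabulate (suc ∘ h)) → Linked _<_ (0 ∷ tabulate (suc ∘ h))
  positive-head {zero}  []  = [-]
  positive-head {suc m} asc = z<s ∷ asc
  reversal⇒ascending : (∀ i → w ⟨$⟩ʳ i ≡ opposite i) → Linked _<_ (tabulate g)
  reversal⇒ascending reversal = Linked.tail (consecutive⇒ascending 0 g λ i →
    cong (suc ∘ toℕ) (trans (reversal (opposite i)) (opposite-involutive i)))
  ascending⇒reversal : Linked _<_ (tabulate g) → ∀ j → w ⟨$⟩ʳ j ≡ opposite j
  ascending⇒reversal asc j = begin
    w ⟨$⟩ʳ j                      ≡⟨ cong (w ⟨$⟩ʳ_) (opposite-involutive j) ⟨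
    w ⟨$⟩ʳ opposite (opposite j)  ≡⟨ toℕ-injective (suc-injective (consecutive (opposite j))) ⟩
    opposite j                    ∎
    where
    open ≡-Reasoning
    consecutive = ascending⇒consecutive 0 g (positive-head asc) (λ i → toℕ<n (w ⟨$⟩ʳ opposite i))

lemma8p4 : (n : ℕ) → 1 ≤ n → (w : Permutation′ n) →
    (StabIs (T w) 1 ⇔ (∀ i → w ⟨$⟩ʳ i ≡ opposite i))
lemma8p4 n _ w = ⇔-sym (reversal⇔ascending w) ⇔-∘ (stable⇔ascending ⇔-∘ StabIs-1⇔StabilizesAt (T w))
  where
  stable⇔ascending : StabilizesAt (T w) 1 ⇔ Linked _<_ (topToBottom w)
  stable⇔ascending rewrite T≡staircase w = staircase-stable⇔ascending (topToBottom-unique w) (topToBottom-bounded w)
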